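{- Let $z\notin\mathbb{N}$ and $Y=\mathbb{N}\cup\{z\}$, and let $f_0$ be the forgetful swap on $Y$ with sequence $(1,2,3,\dots)$, i.e. $f_0(n)=n+1$ for $n\in\mathbb{N}$ and $f_0(z)=z$. Then there exist retentive swaps $f_1,f_3$ and a forgetful swap $f_2$ on $Y$ such that $\mathrm{dom}(f_i)\neq\mathrm{dom}(f_j)$ for all $i\neq j$ in $\{0,1,2,3\}$, the composition $f_3\circ f_2\circ f_1\circ f_0$ is defined on all of $Y$, and $f_3\circ f_2\circ f_1\circ f_0=\mathrm{id}_Y$.
   Context: Here $\mathbb{N}=\{1,2,3,\dots\}$. A swap on a set $Y$ is specified by an infinite sequence $c=(c_1,c_2,\dots)$ of pairwise distinct elements of $Y$; its domain is $\mathrm{dom}=\{c_1,c_2,\dots\}$. The forgetful swap with sequence $c$ is the map $F:Y\to Y$ with $F(c_i)=c_{i+1}$ ($i\ge1$) and $F(y)=y$ for $y\notin\mathrm{dom}$. The retentive swap with sequence $c$ is the partial map $G$ defined on $Y\setminus\{c_1\}$ by $G(c_{i+1})=c_i$ ($i\ge1$) and $G(y)=y$ for $y\notin\mathrm{dom}$; it is undefined at $c_1$. Compositions are of (partial) functions with the rightmost applied first; a composition is defined on $Y$ if at every stage the current point lies where the next map is defined. -}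

module Defs where

open import Data.Nat using (ℕ; zero; suc)
open import Data.Product using (Σ; ∃; _×_; _,_)
open import Data.Sum using (_⊎_)
open import Relation.Nullary using (¬_)
open import Relation.Binary.PropositionalEquality using (_≡_; _≢_)
open import Function.Definitions using (Injective)

-- The set Y = ℕ ∪ {z}, where ℕ = {1,2,3,...}.
-- `pos k` represents the positive natural number k + 1; `z` is the extra point.
data Y : Set where
  z   : Y
  pos : ℕ → Y

-- A swap on Y: an infinite sequence c_1, c_2, ... of pairwise distinct
-- elements of Y.  Indexing is 0-based: (seq i) is c_{i+1}.
record Swap : Set where
  field
    seq : ℕ → Y
    inj : Injective _≡_ _≡_ seq
open Swap public

_∈dom_ : Y → Swap → Set
y ∈dom s = ∃ λ i → y ≡ seq s i

DomDistinct : Swap → Swap → Set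
DomDistinct s t = ¬ (∀ y → (y ∈dom s → y ∈dom t) × (y ∈dom t → y ∈dom s))

-- Graph of the forgetful swap: Forgetful s x y  means  F(x) = y.
-- F(c_i) = c_{i+1};  F(y) = y for y ∉ dom.
Forgetful : Swap → Y → Y → Set
Forgetful s x y =
  (∃ λ i → x ≡ seq s i × y ≡ seq s (suc i))
  ⊎ (¬ (x ∈dom s) × y ≡ x)

-- Graph of the retentive (partial) swap: Retentive s x y  means  G(x) is defined and = y.
-- G(c_{i+1}) = c_i;  G(y) = y for y ∉ dom;  undefined at c_1.
Retentive : Swap → Y → Y → Set
Retentive s x y =
  (∃ λ i → x ≡ seq s (suc i) × y ≡ seq s i)
  ⊎ (¬ (x ∈dom s) × y ≡ x)

f₀ : Swap
f₀ = record { seq = pos ; inj = λ { {x} {.x} _≡_.refl → _≡_.refl } }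

-- Both halves of the composite are the transposition of z and 1.  The retentive
-- swap f₁ along (1, z, 2, 3, …) undoes the shift f₀ on every n ≥ 2, while it
-- sends f₀ z = z to 1 and f₀ 1 = 2 to z.  The forgetful swap f₂ along
-- (z, 1, 2, 4, 6, …) and the retentive swap f₃ along (z, 2, 4, 6, …) cancel on
-- the even numbers, both fix the odd numbers ≥ 3, and f₃ ∘ f₂ sends
-- z ↦ 1 ↦ 1 and 1 ↦ 2 ↦ z.
module Submission where

open import Defs
open import Data.Product using (∃; _×_; _,_; proj₁; proj₂)
open import Data.Sum using (inj₁; inj₂)
open import Data.Nat using (ℕ; zero; suc; _*_)
open import Data.Nat.Properties using (suc-injective; *-cancelˡ-≡; *-suc; even≢odd)
open import Function using (_∘_)
open import Relation.Nullary using (¬_; contradiction)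
open import Relation.Binary.PropositionalEquality using (_≡_; _≢_; refl; sym; cong; subst)

data EvenOrOdd : ℕ → Set where
  even : ∀ i → EvenOrOdd (2 * i)
  odd  : ∀ i → EvenOrOdd (suc (2 * i))

evenOrOdd : ∀ n → EvenOrOdd n
evenOrOdd zero = even 0
evenOrOdd (suc n) with evenOrOdd n
... | even i = odd i
... | odd i  = subst EvenOrOdd (*-suc 2 i) (even (suc i))

pos-injective : ∀ {m n} → pos m ≡ pos n → m ≡ n
pos-injective refl = refl

module _ (s : Swap) where

  forgetful-next : ∀ i → Forgetful s (seq s i) (seq s (suc i))
  forgetful-next i = inj₁ (i , refl , refl)

  forgetful-fixed : ∀ {x} → ¬ x ∈dom s → Forgetful s x x
  forgetful-fixed x∉s = inj₂ (x∉s , refl)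

  retentive-prev : ∀ i → Retentive s (seq s (suc i)) (seq s i)
  retentive-prev i = inj₁ (i , refl , refl)

  retentive-fixed : ∀ {x} → ¬ x ∈dom s → Retentive s x x
  retentive-fixed x∉s = inj₂ (x∉s , refl)

module _ (s t : Swap) {x : Y} where

  ∈∉⇒domDistinct : x ∈dom s → ¬ x ∈dom t → DomDistinct s t
  ∈∉⇒domDistinct x∈s x∉t same = x∉t (proj₁ (same x) x∈s)

  ∉∈⇒domDistinct : ¬ x ∈dom s → x ∈dom t → DomDistinct s t
  ∉∈⇒domDistinct x∉s x∈t same = x∉s (proj₂ (same x) x∈t)

tail : Swap → Swap
tail s = record { seq = seq s ∘ suc ; inj = suc-injective ∘ inj s }

prepend : (y : Y) (s : Swap) → ¬ y ∈dom s → Swap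
prepend y s y∉s = record { seq = seq′ ; inj = seq′-injective }
  where
  seq′ : ℕ → Y
  seq′ zero    = y
  seq′ (suc i) = seq s i

  seq′-injective : ∀ {i j} → seq′ i ≡ seq′ j → i ≡ j
  seq′-injective {zero}  {zero}  _ = refl
  seq′-injective {zero}  {suc j} e = contradiction (j , e) y∉s
  seq′-injective {suc i} {zero}  e = contradiction (i , sym e) y∉s
  seq′-injective {suc i} {suc j} e = cong suc (inj s e)

∉dom-prepend : ∀ {x} y s (y∉s : ¬ y ∈dom s) → x ≢ y → ¬ x ∈dom s → ¬ x ∈dom prepend y s y∉s
∉dom-prepend _ _ _ x≢y x∉s (zero  , e) = x≢y e
∉dom-prepend _ _ _ x≢y x∉s (suc i , e) = x∉s (i , e)

-- seq evens i is the number 2i + 2.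
evens : Swap
evens = record
  { seq = λ i → pos (suc (2 * i))
  ; inj = λ {i} {j} → *-cancelˡ-≡ i j 2 ∘ suc-injective ∘ pos-injective
  }

pos0∉dom-evens : ¬ pos 0 ∈dom evens
pos0∉dom-evens (_ , ())

odd∉dom-evens : ∀ i → ¬ pos (suc (suc (2 * i))) ∈dom evens
odd∉dom-evens i (j , e) = even≢odd j i (sym (suc-injective (pos-injective e)))

z∉dom-evens : ¬ z ∈dom evens
z∉dom-evens (_ , ())

z∉dom-f₀ : ¬ z ∈dom f₀
z∉dom-f₀ (_ , ())

z∉dom-tail-f₀ : ¬ z ∈dom tail f₀
z∉dom-tail-f₀ (_ , ())

pos0∉dom-tail-f₀ : ¬ pos 0 ∈dom tail f₀
pos0∉dom-tail-f₀ (_ , ())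

1∷evens : Swap
1∷evens = prepend (pos 0) evens pos0∉dom-evens

z∉dom-1∷evens : ¬ z ∈dom 1∷evens
z∉dom-1∷evens = ∉dom-prepend (pos 0) evens pos0∉dom-evens (λ ()) z∉dom-evens

f₁ f₂ f₃ : Swap
f₁ = prepend (pos 0) (prepend z (tail f₀) z∉dom-tail-f₀)
       (∉dom-prepend z (tail f₀) z∉dom-tail-f₀ (λ ()) pos0∉dom-tail-f₀)
f₂ = prepend z 1∷evens z∉dom-1∷evens
f₃ = prepend z evens z∉dom-evens

pos0∉dom-f₃ : ¬ pos 0 ∈dom f₃
pos0∉dom-f₃ = ∉dom-prepend z evens z∉dom-evens (λ ()) pos0∉dom-evens

odd∉dom-f₂ : ∀ i → ¬ pos (suc (suc (2 * i))) ∈dom f₂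
odd∉dom-f₂ i = ∉dom-prepend z 1∷evens z∉dom-1∷evens (λ ())
  (∉dom-prepend (pos 0) evens pos0∉dom-evens (λ ()) (odd∉dom-evens i))

odd∉dom-f₃ : ∀ i → ¬ pos (suc (suc (2 * i))) ∈dom f₃
odd∉dom-f₃ i = ∉dom-prepend z evens z∉dom-evens (λ ()) (odd∉dom-evens i)

f₃∘f₂-fixes-≥2 : ∀ k → ∃ λ y → Forgetful f₂ (pos (suc k)) y × Retentive f₃ y (pos (suc k))
f₃∘f₂-fixes-≥2 k with evenOrOdd k
... | even i = _ , forgetful-next f₂ (suc (suc i)) , retentive-prev f₃ (suc i)
... | odd i  = _ , forgetful-fixed f₂ (odd∉dom-f₂ i) , retentive-fixed f₃ (odd∉dom-f₃ i)

f₃∘f₂∘f₁∘f₀≡id : ∀ y → ∃ λ y₁ → ∃ λ y₂ → ∃ λ y₃ →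
  Forgetful f₀ y y₁ × Retentive f₁ y₁ y₂ × Forgetful f₂ y₂ y₃ × Retentive f₃ y₃ y
f₃∘f₂∘f₁∘f₀≡id z = z , pos 0 , pos 1 ,
  forgetful-fixed f₀ z∉dom-f₀ , retentive-prev f₁ 0 , forgetful-next f₂ 1 , retentive-prev f₃ 0
f₃∘f₂∘f₁∘f₀≡id (pos zero) = pos 1 , z , pos 0 ,
  forgetful-next f₀ 0 , retentive-prev f₁ 1 , forgetful-next f₂ 0 , retentive-fixed f₃ pos0∉dom-f₃
f₃∘f₂∘f₁∘f₀≡id (pos (suc k)) =
  let y₃ , f₂-step , f₃-step = f₃∘f₂-fixes-≥2 k
  in pos (suc (suc k)) , pos (suc k) , y₃ ,
     forgetful-next f₀ (suc k) , retentive-prev f₁ (suc (suc k)) , f₂-step , f₃-step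

mainTheorem13 : ∃ λ (f₁ : Swap) → ∃ λ (f₂ : Swap) → ∃ λ (f₃ : Swap) →
    (DomDistinct f₀ f₁ × DomDistinct f₀ f₂ × DomDistinct f₀ f₃
    × DomDistinct f₁ f₂ × DomDistinct f₁ f₃ × DomDistinct f₂ f₃)
    × (∀ (y : Y) → ∃ λ y₁ → ∃ λ y₂ → ∃ λ y₃ →
    Forgetful f₀ y y₁ × Retentive f₁ y₁ y₂ × Forgetful f₂ y₂ y₃ × Retentive f₃ y₃ y)
mainTheorem13 = f₁ , f₂ , f₃ ,
  ( ∉∈⇒domDistinct f₀ f₁ z∉dom-f₀ (1 , refl)
  , ∉∈⇒domDistinct f₀ f₂ z∉dom-f₀ (0 , refl)
  , ∉∈⇒domDistinct f₀ f₃ z∉dom-f₀ (0 , refl)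
  , ∈∉⇒domDistinct f₁ f₂ (3 , refl) (odd∉dom-f₂ 0)
  , ∈∉⇒domDistinct f₁ f₃ (0 , refl) pos0∉dom-f₃
  , ∈∉⇒domDistinct f₂ f₃ (1 , refl) pos0∉dom-f₃ )
  , f₃∘f₂∘f₁∘f₀≡id
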